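{- Let $a<b$ be real numbers, $Y=\{a,b\}$, and $X=Y^{\mathbb{N}}$. There does not exist a function $W:X\to\mathbb{R}$ representing a social welfare order $\succsim$ on $X$ (i.e., $x\succsim y \iff W(x)\ge W(y)$ for all $x,y\in X$) such that $\succsim$ satisfies both Upper Asymptotic Pareto and Anonymity.
   Context: A social welfare order on $X$ is a complete and transitive binary relation $\succsim$ on $X$; $\sim$ and $\succ$ denote its symmetric and asymmetric parts. For $x,y\in\mathbb{R}^{\mathbb{N}}$, $x\ge y$ means $x_n\ge y_n$ for all $n\in\mathbb{N}$. For $S\subset\mathbb{N}$, the upper asymptotic density is $\overline{d}(S)=\limsup_{n\to\infty}\frac{|S\cap\{1,\dots,n\}|}{n}$. Anonymity: if $x,y\in X$ and there exist $i,j\in\mathbb{N}$ with $y_j=x_i$, $x_j=y_i$, and $y_k=x_k$ for all $k\in\mathbb{N}\setminus\{i,j\}$, then $x\sim y$. Upper Asymptotic Pareto: for $x,y\in X$, if $x\ge y$ and $x_i>y_i$ for all $i\in S$, where $S\subset\mathbb{N}$ satisfies $\overline{d}(S)>0$, then $x\succ y$. -}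

module Defs where

open import Level using (0ℓ) renaming (suc to lsuc)
open import Data.Bool using (Bool; true; false; if_then_else_)
open import Data.Nat using (ℕ; zero; suc; _+_; _*_) renaming (_≤_ to _≤ℕ_)
open import Data.Rational using (ℚ) renaming (_<_ to _<ℚ_)
open import Data.Product using (Σ; ∃; _×_; _,_)
open import Data.Empty using (⊥)
open import Relation.Nullary using (¬_)
open import Relation.Binary.PropositionalEquality using (_≡_; _≢_)
open import Data.Sum using (_⊎_)

record ℝ : Set₁ where
  field
    L : ℚ → Set
    U : ℚ → Set
    L-inhabited : ∃ λ q → L q
    U-inhabited : ∃ λ q → U q
    L-rounded   : ∀ q → L q → ∃ λ r → q <ℚ r × L r
    L-down      : ∀ q r → q <ℚ r → L r → L q
    U-rounded   : ∀ q → U q → ∃ λ r → r <ℚ q × U r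
    U-up        : ∀ q r → q <ℚ r → U q → U r
    disjoint    : ∀ q → L q → U q → ⊥
    located     : ∀ q r → q <ℚ r → L q ⊎ U r

open ℝ public

_<ℝ_ : ℝ → ℝ → Set
x <ℝ y = ∃ λ q → U x q × L y q

_≤ℝ_ : ℝ → ℝ → Set
x ≤ℝ y = ∀ q → L x q → L y q

-- The space X = Y^ℕ with Y = {a , b}: a point of X is coded by a Bool
-- sequence, false ↦ a, true ↦ b.

Seq : Set
Seq = ℕ → Bool

val : ℝ → ℝ → Bool → ℝ
val a b false = a
val a b true  = b

-- Upper asymptotic density.  Subsets of ℕ are given by characteristic
-- functions; index i : ℕ stands for the natural number i+1.

count : (ℕ → Bool) → ℕ → ℕ
count S zero    = zero
count S (suc n) = count S n + (if S n then 1 else 0)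

-- d̄(S) > 0  iff  ∃ k, for infinitely many n, count S n / n ≥ 1/(k+1)
UpperDensityPos : (ℕ → Bool) → Set
UpperDensityPos S = ∃ λ k → ∀ m → ∃ λ n → m ≤ℕ n × n ≤ℕ suc k * count S n

module _ (W : Seq → ℝ) where
  _≿_ : Seq → Seq → Set
  x ≿ y = W y ≤ℝ W x

  _∼_ : Seq → Seq → Set
  x ∼ y = (x ≿ y) × (y ≿ x)

  _≻_ : Seq → Seq → Set
  x ≻ y = (x ≿ y) × ¬ (y ≿ x)

Anonymity : (Seq → ℝ) → Set
Anonymity W = ∀ (x y : Seq) (i j : ℕ) →
  y j ≡ x i → x j ≡ y i → (∀ k → k ≢ i → k ≢ j → y k ≡ x k) →
  _∼_ W x y

UpperAsymptoticPareto : ℝ → ℝ → (Seq → ℝ) → Set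
UpperAsymptoticPareto a b W = ∀ (x y : Seq) (S : ℕ → Bool) →
  (∀ n → val a b (y n) ≤ℝ val a b (x n)) →
  UpperDensityPos S →
  (∀ i → S i ≡ true → val a b (y i) <ℝ val a b (x i)) →
  _≻_ W x y

-- Read a bit sequence t as a path through the infinite binary tree and give each node four
-- slots, each slot owning a block of coordinates at least as long as all earlier blocks together.
-- The points lower t and upper t fill all slots of the nodes left of the path, none to its
-- right, and 1 + t d resp. 2 + t d slots of the path node at depth d; upper t beats lower t on
-- a set of positive upper density, so W (lower t) < W (upper t) by Upper Asymptotic Pareto.
-- For each node, a profile split u n lies weakly above the upper points of all paths through its
-- left subtree (after finitely many exchanges of coordinates, allowed by Anonymity) and weakly
-- below the lower points of all paths through its right subtree. Choosing the path T bit by bit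
-- against an enumeration of the pairs of rationals q < r, no such gap fits between W (lower T)
-- and W (upper T), hence W (upper T) ≤ W (lower T), a contradiction. This is the constructive
-- form of the classical argument that uncountably many disjoint intervals cannot each contain a
-- rational.

module Submission where

open import Defs
open import Data.Product using (Σ; _×_)
open import Relation.Nullary using (¬_)

open import Data.Bool using (Bool; true; false)
open import Data.Empty using (⊥; ⊥-elim)
open import Data.Integer as ℤ using (ℤ)
open import Data.Nat
open import Data.Nat.DivMod
  using (_/_; _%_; m*n/n≡m; m*n%n≡0; m<n⇒m/n≡0; m<n⇒m%n≡m; +-distrib-/; [m+kn]%n≡m%n; /-monoˡ-≤)
open import Data.Nat.Properties
open import Data.Product using (∃; ∃₂; _,_; proj₁; proj₂; map)
open import Function using (_∘_; id)
open import Data.Rational using (ℚ; ↥_) renaming (_<_ to _<ℚ_; _/_ to _÷_)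
import Data.Rational.Properties as ℚₚ
open import Data.Sum using (_⊎_; inj₁; inj₂)
open import Relation.Binary using (tri<; tri≈; tri>)
open import Relation.Binary.PropositionalEquality
open import Relation.Nullary using (Dec; yes; no; does; ¬?; _×-dec_)
open import Relation.Nullary.Decidable using (dec-true; dec-false)
open import Relation.Unary using (Decidable)

L<U : (x : ℝ) {q r : ℚ} → L x q → U x r → q <ℚ r
L<U x {q} {r} lq ur with ℚₚ.<-cmp q r
... | tri< q<r _ _ = q<r
... | tri≈ _ refl _ = ⊥-elim (disjoint x q lq ur)
... | tri> _ _ r<q = ⊥-elim (disjoint x q lq (U-up x r q r<q ur))

<ℝ⇒≤ℝ : {x y : ℝ} → x <ℝ y → x ≤ℝ y
<ℝ⇒≤ℝ {x} {y} (q , uq , lq) r lr = L-down y r q (L<U x lr uq) lq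

≤ℝ-refl : {x : ℝ} → x ≤ℝ x
≤ℝ-refl _ lq = lq

≤ℝ-trans : {x y z : ℝ} → x ≤ℝ y → y ≤ℝ z → x ≤ℝ z
≤ℝ-trans x≤y y≤z q lq = y≤z q (x≤y q lq)

≤ℝ-if-no-gap : (x y : ℝ) → (∀ q r → q <ℚ r → U x q → L y r → ⊥) → y ≤ℝ x
≤ℝ-if-no-gap x y no-gap q lq with L-rounded y q lq
... | r , q<r , lr with located x q r q<r
...   | inj₁ lxq = lxq
...   | inj₂ uxr with U-rounded x r uxr | L-rounded y r lr
...     | q′ , q′<r , uxq′ | r′ , r<r′ , lyr′ =
          ⊥-elim (no-gap q′ r′ (ℚₚ.<-trans q′<r r<r′) uxq′ lyr′)

LocatedAt : ℚ × ℚ → ℝ → Bool → Set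
LocatedAt (q , r) x β = q <ℚ r → (β ≡ true × L x q) ⊎ (β ≡ false × U x r)

locate : ∀ qr x → Σ Bool (LocatedAt qr x)
locate (q , r) x with q ℚₚ.<? r
... | no q≮r = false , λ q<r → ⊥-elim (q≮r q<r)
... | yes q<r with located x q r q<r
...   | inj₁ lq = true , λ _ → inj₁ (refl , lq)
...   | inj₂ ur = false , λ _ → inj₂ (refl , ur)

Enumeration : Set → Set
Enumeration A = Σ (ℕ → A) λ f → ∀ a → ∃ λ n → f n ≡ a

cantorStep : ℕ × ℕ → ℕ × ℕ
cantorStep (i , zero)  = 0 , suc i
cantorStep (i , suc j) = suc i , j

unpair : ℕ → ℕ × ℕ
unpair zero    = 0 , 0
unpair (suc n) = cantorStep (unpair n)

unpair-diagonal : ∀ s i → i ≤ s → ∃ λ n → unpair n ≡ (i , s ∸ i)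
unpair-diagonal zero    zero    _ = 0 , refl
unpair-diagonal (suc s) zero    _ with unpair-diagonal s s ≤-refl
... | n , e rewrite n∸n≡0 s = suc n , cong cantorStep e
unpair-diagonal s (suc i) i<s with unpair-diagonal s i (<⇒≤ i<s)
... | n , e rewrite +-∸-assoc 1 i<s = suc n , cong cantorStep e

unpair-onto : ∀ ij → ∃ λ n → unpair n ≡ ij
unpair-onto (i , j) with unpair-diagonal (i + j) i (m≤m+n i j)
... | n , e rewrite m+n∸m≡n i j = n , e

enumerate-map : {A B : Set} (f : A → B) → (∀ b → ∃ λ a → f a ≡ b) → Enumeration A → Enumeration B
enumerate-map f f-onto (e , e-onto) = f ∘ e , onto
  where
  onto : ∀ b → ∃ λ n → f (e n) ≡ b
  onto b with f-onto b
  ... | a , refl with e-onto a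
  ...   | n , refl = n , refl

enumerate-ℕ² : Enumeration (ℕ × ℕ)
enumerate-ℕ² = unpair , unpair-onto

enumerate-× : {A B : Set} → Enumeration A → Enumeration B → Enumeration (A × B)
enumerate-× (e , e-onto) (e′ , e′-onto) = enumerate-map (map e e′) onto enumerate-ℕ²
  where
  onto : ∀ ab → ∃ λ ij → map e e′ ij ≡ ab
  onto (a , b) with e-onto a | e′-onto b
  ... | i , refl | j , refl = (i , j) , refl

enumerate-ℤ : Enumeration ℤ
enumerate-ℤ = enumerate-map toℤ onto enumerate-ℕ²
  where
  toℤ : ℕ × ℕ → ℤ
  toℤ (n , zero)  = ℤ.+ n
  toℤ (_ , suc n) = ℤ.-[1+ n ]
  onto : ∀ z → ∃ λ ij → toℤ ij ≡ z
  onto (ℤ.+ n)     = (n , 0) , refl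
  onto ℤ.-[1+ n ]  = (0 , suc n) , refl

enumerate-ℚ : Enumeration ℚ
enumerate-ℚ = enumerate-map toℚ onto (enumerate-× enumerate-ℤ (id , λ n → n , refl))
  where
  toℚ : ℤ × ℕ → ℚ
  toℚ (z , d) = z ÷ suc d
  onto : ∀ q → ∃ λ zd → toℚ zd ≡ q
  onto q = (↥ q , ℚ.denominator-1 q) , ℚₚ.↥p/↧p≡p q

AgreeBelow : ℕ → Seq → Seq → Set
AgreeBelow n u t = ∀ i → i < n → u i ≡ t i

_⊑_ : Seq → Seq → Set
y ⊑ x = ∀ i → y i ≡ true → x i ≡ true

_⊆_∖_ : Seq → Seq → Seq → Set
S ⊆ x ∖ y = ∀ i → S i ≡ true → x i ≡ true × y i ≡ false

module Diagonal (P : ℕ → Seq → Bool → Set) (choose : ∀ n u → Σ Bool (P n u)) where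

  prefix : ℕ → Seq
  prefix zero    _ = false
  prefix (suc n) i with i ≟ n
  ... | yes _ = proj₁ (choose n (prefix n))
  ... | no  _ = prefix n i

  diagonal : Seq
  diagonal i = prefix (suc i) i

  diagonal-chosen : ∀ n → diagonal n ≡ proj₁ (choose n (prefix n))
  diagonal-chosen n with n ≟ n
  ... | yes _  = refl
  ... | no n≢n = ⊥-elim (n≢n refl)

  diagonal-satisfies : ∀ n → P n (prefix n) (diagonal n)
  diagonal-satisfies n = subst (P n (prefix n)) (sym (diagonal-chosen n)) (proj₂ (choose n (prefix n)))

  prefix-agree : ∀ n → AgreeBelow n (prefix n) diagonal
  prefix-agree (suc n) i i<1+n with i ≟ n
  ... | yes refl = sym (diagonal-chosen n)
  ... | no  i≢n  = prefix-agree n i (≤∧≢⇒< (≤-pred i<1+n) i≢n)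

-- Breadth-first enumeration of the nodes (d , c), c < 2 ^ d, of the infinite binary tree.
Node : Set
Node = ℕ × ℕ

ValidNode : Node → Set
ValidNode (d , c) = c < 2 ^ d

levelStart : ℕ → ℕ
levelStart zero    = 0
levelStart (suc d) = levelStart d + 2 ^ d

index : Node → ℕ
index (d , c) = levelStart d + c

nextNode : Node → Node
nextNode (d , c) with suc c <? 2 ^ d
... | yes _ = d , suc c
... | no  _ = suc d , 0

node : ℕ → Node
node zero    = 0 , 0
node (suc m) = nextNode (node m)

suc-levelStart : ∀ d → suc (levelStart d) ≡ 2 ^ d
suc-levelStart zero    = refl
suc-levelStart (suc d) = begin
  suc (levelStart d + 2 ^ d)   ≡⟨ cong (_+ 2 ^ d) (suc-levelStart d) ⟩
  2 ^ d + 2 ^ d           ≡⟨ cong (2 ^ d +_) (sym (+-identityʳ (2 ^ d))) ⟩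
  2 * 2 ^ d               ∎
  where open ≡-Reasoning

levelStart<2^ : ∀ d → levelStart d < 2 ^ d
levelStart<2^ d = ≤-reflexive (suc-levelStart d)

n≤levelStart : ∀ d → d ≤ levelStart d
n≤levelStart zero    = z≤n
n≤levelStart (suc d) = subst (_≤ levelStart d + 2 ^ d) (+-comm d 1) (+-mono-≤ (n≤levelStart d) (m^n>0 2 d))

levelStart-mono : ∀ {d d′} → d ≤ d′ → levelStart d ≤ levelStart d′
levelStart-mono {d′ = zero}  z≤n = ≤-refl
levelStart-mono {d′ = suc d′} d≤1+d′ with m≤n⇒m<n∨m≡n d≤1+d′
... | inj₁ d<1+d′ = ≤-trans (levelStart-mono (≤-pred d<1+d′)) (m≤m+n (levelStart d′) _)
... | inj₂ refl = ≤-refl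

nextNode-index : ∀ x → ValidNode x → index (nextNode x) ≡ suc (index x) × ValidNode (nextNode x)
nextNode-index (d , c) c<2^d with suc c <? 2 ^ d
... | yes c+1<2^d = +-suc (levelStart d) c , c+1<2^d
... | no  c+1≮2^d = index-next , m^n>0 2 (suc d)
  where
  index-next : levelStart d + 2 ^ d + 0 ≡ suc (levelStart d + c)
  index-next = begin
    levelStart d + 2 ^ d + 0   ≡⟨ +-identityʳ _ ⟩
    levelStart d + 2 ^ d       ≡⟨ cong (levelStart d +_) (≤-antisym c<2^d (≮⇒≥ c+1≮2^d)) ⟨
    levelStart d + suc c       ≡⟨ +-suc (levelStart d) c ⟩
    suc (levelStart d + c)     ∎
    where open ≡-Reasoning

node-index : ∀ m → index (node m) ≡ m × ValidNode (node m)
node-index zero    = refl , s≤s z≤n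
node-index (suc m) with node-index m
... | index≡m , valid with nextNode-index (node m) valid
...   | index≡1+ , valid′ = trans index≡1+ (cong suc index≡m) , valid′

index<levelStart : ∀ {d c d′} → c < 2 ^ d → d < d′ → index (d , c) < levelStart d′
index<levelStart {d} c<2^d d<d′ = ≤-trans (+-monoʳ-< (levelStart d) c<2^d) (levelStart-mono d<d′)

index-injective : ∀ x y → ValidNode x → ValidNode y → index x ≡ index y → x ≡ y
index-injective (d , c) (d′ , c′) c<2^d c′<2^d′ eq with <-cmp d d′
... | tri< d<d′ _ _ = ⊥-elim (<-irrefl eq (<-≤-trans (index<levelStart c<2^d d<d′) (m≤m+n _ c′)))
... | tri≈ _ refl _ = cong (d ,_) (+-cancelˡ-≡ (levelStart d) c c′ eq)
... | tri> _ _ d′<d = ⊥-elim (<-irrefl (sym eq) (<-≤-trans (index<levelStart c′<2^d′ d′<d) (m≤m+n _ c)))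

node-index⁻¹ : ∀ x → ValidNode x → node (index x) ≡ x
node-index⁻¹ x valid with node-index (index x)
... | index≡ , valid′ = index-injective (node (index x)) x valid′ valid index≡

levelStart≤⇒≤depth : ∀ {d m} → levelStart d ≤ m → d ≤ proj₁ (node m)
levelStart≤⇒≤depth {d} {m} levelStart≤m with node m | node-index m
... | d′ , c′ | refl , c′<2^d′ with d ≤? d′
...   | yes d≤d′ = d≤d′
...   | no  d≰d′ = ⊥-elim (<⇒≱ (index<levelStart c′<2^d′ (≰⇒> d≰d′)) levelStart≤m)

-- A cell is one of the four slots of a node; a cell index j stands for node j / 4, slot j % 4.
Cell : Set
Cell = ℕ × ℕ × ℕ

depth : Cell → ℕ
depth (d , _ , _) = d

ValidCell : Cell → Set
ValidCell (d , c , s) = c < 2 ^ d × s < 4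

cell : ℕ → Cell
cell j = proj₁ (node (j / 4)) , proj₂ (node (j / 4)) , j % 4

cellIndex : Cell → ℕ
cellIndex (d , c , s) = s + index (d , c) * 4

[s+m*4]/4≡m : ∀ {s} m → s < 4 → (s + m * 4) / 4 ≡ m
[s+m*4]/4≡m {s} m s<4 = begin
  (s + m * 4) / 4       ≡⟨ +-distrib-/ s (m * 4) no-carry ⟩
  s / 4 + m * 4 / 4     ≡⟨ cong₂ _+_ (m<n⇒m/n≡0 s<4) (m*n/n≡m m 4) ⟩
  m                     ∎
  where
  open ≡-Reasoning
  no-carry : s % 4 + m * 4 % 4 < 4
  no-carry = subst (_< 4) (sym (trans (cong₂ _+_ (m<n⇒m%n≡m s<4) (m*n%n≡0 m 4)) (+-identityʳ s))) s<4

[s+m*4]%4≡s : ∀ {s} m → s < 4 → (s + m * 4) % 4 ≡ s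
[s+m*4]%4≡s {s} m s<4 = trans ([m+kn]%n≡m%n s m 4) (m<n⇒m%n≡m s<4)

cell-cellIndex : ∀ x → ValidCell x → cell (cellIndex x) ≡ x
cell-cellIndex (d , c , s) (c<2^d , s<4)
  rewrite [s+m*4]/4≡m (index (d , c)) s<4
        | [s+m*4]%4≡s (index (d , c)) s<4
        | node-index⁻¹ (d , c) c<2^d = refl

depth≤cellIndex : ∀ x → depth x ≤ cellIndex x
depth≤cellIndex (d , c , s) = begin
  d                       ≤⟨ n≤levelStart d ⟩
  levelStart d                 ≤⟨ m≤m+n (levelStart d) c ⟩
  levelStart d + c             ≤⟨ m≤m*n (levelStart d + c) 4 ⟩
  (levelStart d + c) * 4       ≤⟨ m≤n+m _ s ⟩
  s + (levelStart d + c) * 4   ∎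
  where open ≤-Reasoning

-- Position i of a sequence belongs to the cell whose index is the depth of node i, so the
-- positions of cell j form the block levelStart j , … , levelStart j + 2 ^ j − 1, which is longer than all
-- earlier blocks together.
cellOf : ℕ → Cell
cellOf i = cell (proj₁ (node i))

cellOf-block : ∀ j {r} → r < 2 ^ j → cellOf (levelStart j + r) ≡ cell j
cellOf-block j r<2^j = cong (cell ∘ proj₁) (node-index⁻¹ (j , _) r<2^j)

depth-cellOf : ∀ n {i} → levelStart (levelStart n * 4) ≤ i → n ≤ depth (cellOf i)
depth-cellOf n {i} levelStart≤i =
  levelStart≤⇒≤depth (subst (_≤ proj₁ (node i) / 4) (m*n/n≡m (levelStart n) 4)
                        (/-monoˡ-≤ 4 (levelStart≤⇒≤depth {levelStart n * 4} levelStart≤i)))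

cellwise : {P : Cell → Set} → Decidable P → Seq
cellwise P? i = does (P? (cellOf i))

count-run : ∀ S a n → (∀ r → r < n → S (a + r) ≡ true) → n ≤ count S (a + n)
count-run S a zero    _   = z≤n
count-run S a (suc n) run rewrite +-suc a n | run n ≤-refl =
  subst (suc n ≤_) (+-comm 1 _) (s≤s (count-run S a n (λ r r<n → run r (m<n⇒m<1+n r<n))))

cellwise-dense : {P : Cell → Set} (P? : Decidable P) →
  (∀ m → ∃ λ x → m ≤ depth x × ValidCell x × P x) → UpperDensityPos (cellwise P?)
cellwise-dense {P} P? deep = 1 , λ m → dense-at (deep m)
  where
  dense-at : ∀ {m} → (∃ λ x → m ≤ depth x × ValidCell x × P x) →
             ∃ λ n → m ≤ n × n ≤ 2 * count (cellwise P?) n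
  dense-at {m} (x , m≤d , valid , px) = levelStart j + 2 ^ j , m≤n , n≤2*count
    where
    j = cellIndex x
    k = count (cellwise P?) (levelStart j + 2 ^ j)
    in-block : ∀ r → r < 2 ^ j → cellwise P? (levelStart j + r) ≡ true
    in-block r r<2^j rewrite cellOf-block j r<2^j | cell-cellIndex x valid = dec-true (P? x) px
    2^j≤k : 2 ^ j ≤ k
    2^j≤k = count-run (cellwise P?) (levelStart j) (2 ^ j) in-block
    m≤n : m ≤ levelStart j + 2 ^ j
    m≤n = ≤-trans m≤d (≤-trans (depth≤cellIndex x) (≤-trans (n≤levelStart j) (m≤m+n _ _)))
    n≤2*count : levelStart j + 2 ^ j ≤ 2 * k
    n≤2*count = begin
      levelStart j + 2 ^ j   ≤⟨ +-mono-≤ (<⇒≤ (levelStart<2^ j)) ≤-refl ⟩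
      2 ^ j + 2 ^ j     ≤⟨ +-mono-≤ 2^j≤k 2^j≤k ⟩
      k + k             ≡⟨ cong (k +_) (+-identityʳ k) ⟨
      2 * k             ∎
      where open ≤-Reasoning

bit : Bool → ℕ
bit false = 0
bit true  = 1

bit≤1 : ∀ β → bit β ≤ 1
bit≤1 false = z≤n
bit≤1 true  = ≤-refl

2+bit<4 : ∀ β → 2 + bit β < 4
2+bit<4 β = s≤s (s≤s (s≤s (bit≤1 β)))

bit-mono : ∀ {β γ} → (β ≡ true → γ ≡ true) → bit β ≤ bit γ
bit-mono {false}         _   = z≤n
bit-mono {true}  {true}  _   = ≤-refl
bit-mono {true}  {false} β⇒γ with β⇒γ refl
... | ()

-- t read as a path from the root turning right at depth i iff t i; column c has children 2c, 2c + 1.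
pathColumn : Seq → ℕ → ℕ
pathColumn t zero    = 0
pathColumn t (suc d) = 2 * pathColumn t d + bit (t d)

pathColumn-lower : ∀ t d k → 2 ^ k * pathColumn t d ≤ pathColumn t (k + d)
pathColumn-lower t d zero    = ≤-reflexive (+-identityʳ _)
pathColumn-lower t d (suc k) = begin
  2 * 2 ^ k * pathColumn t d       ≡⟨ *-assoc 2 (2 ^ k) _ ⟩
  2 * (2 ^ k * pathColumn t d)     ≤⟨ *-monoʳ-≤ 2 (pathColumn-lower t d k) ⟩
  2 * pathColumn t (k + d)         ≤⟨ m≤m+n _ _ ⟩
  pathColumn t (suc k + d)         ∎
  where open ≤-Reasoning

pathColumn-upper : ∀ t d k → pathColumn t (k + d) < 2 ^ k * suc (pathColumn t d)
pathColumn-upper t d zero    = s≤s (≤-reflexive (sym (+-identityʳ _)))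
pathColumn-upper t d (suc k) = begin-strict
  2 * p + bit (t (k + d))          <⟨ +-monoʳ-< (2 * p) (s≤s (bit≤1 _)) ⟩
  2 * p + 2                        ≡⟨ trans (+-comm (2 * p) 2) (sym (*-suc 2 p)) ⟩
  2 * suc p                        ≤⟨ *-monoʳ-≤ 2 (pathColumn-upper t d k) ⟩
  2 * (2 ^ k * suc (pathColumn t d)) ≡⟨ *-assoc 2 (2 ^ k) _ ⟨
  2 * 2 ^ k * suc (pathColumn t d) ∎
  where
  open ≤-Reasoning
  p = pathColumn t (k + d)

pathColumn<2^ : ∀ t d → pathColumn t d < 2 ^ d
pathColumn<2^ t d = subst₂ _<_ (cong (pathColumn t) (+-identityʳ d)) (*-identityʳ (2 ^ d)) (pathColumn-upper t 0 d)

pathColumn-cong : ∀ {s t} d → AgreeBelow d s t → pathColumn s d ≡ pathColumn t d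
pathColumn-cong zero    _     = refl
pathColumn-cong (suc d) agree =
  cong₂ (λ p β → 2 * p + bit β) (pathColumn-cong d (λ i i<d → agree i (m<n⇒m<1+n i<d))) (agree d ≤-refl)

pathColumn-mono : ∀ {s t} → s ⊑ t → ∀ d → pathColumn s d ≤ pathColumn t d
pathColumn-mono s⊑t zero    = z≤n
pathColumn-mono s⊑t (suc d) = +-mono-≤ (*-monoʳ-≤ 2 (pathColumn-mono s⊑t d)) (bit-mono (s⊑t d))

pathColumn-split : ∀ {s t n d} → AgreeBelow n s t → s n ≡ false → t n ≡ true → n < d →
                   pathColumn s d < pathColumn t d
pathColumn-split {s} {t} {n} agree sn tn n<d with m≤n⇒∃[o]m+o≡n n<d
... | k , refl = subst (λ d → pathColumn s d < pathColumn t d) (+-comm k (suc n)) apart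
  where
  open ≤-Reasoning
  siblings : suc (pathColumn s (suc n)) ≡ pathColumn t (suc n)
  siblings rewrite sn | tn | pathColumn-cong n agree = trans (cong suc (+-identityʳ _)) (+-comm 1 _)
  apart : pathColumn s (k + suc n) < pathColumn t (k + suc n)
  apart = begin-strict
    pathColumn s (k + suc n)            <⟨ pathColumn-upper s (suc n) k ⟩
    2 ^ k * suc (pathColumn s (suc n))  ≡⟨ cong (2 ^ k *_) siblings ⟩
    2 ^ k * pathColumn t (suc n)        ≤⟨ pathColumn-lower t (suc n) k ⟩
    pathColumn t (k + suc n)            ∎

mark : ℕ → ℕ → ℕ → ℕ
mark p e c with <-cmp c p
... | tri< _ _ _ = 4
... | tri≈ _ _ _ = e
... | tri> _ _ _ = 0

mark-on-path : ∀ p e → mark p e p ≡ e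
mark-on-path p e with <-cmp p p
... | tri< p<p _ _ = ⊥-elim (<-irrefl refl p<p)
... | tri≈ _ _ _   = refl
... | tri> _ _ p<p = ⊥-elim (<-irrefl refl p<p)

mark-left : ∀ {p c} e → c < p → mark p e c ≡ 4
mark-left {p} {c} e c<p with <-cmp c p
... | tri< _ _ _    = refl
... | tri≈ c≮p _ _  = ⊥-elim (c≮p c<p)
... | tri> c≮p _ _  = ⊥-elim (c≮p c<p)

mark-≤ : ∀ {p c} e → p ≤ c → mark p e c ≤ e
mark-≤ {p} {c} e p≤c with <-cmp c p
... | tri< c<p _ _ = ⊥-elim (<⇒≱ c<p p≤c)
... | tri≈ _ _ _   = ≤-refl
... | tri> _ _ _   = z≤n

mark-mono : ∀ {p q e e′} c → p ≤ q → (p ≡ q → e ≤ e′) → e ≤ 4 → mark p e c ≤ mark q e′ c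
mark-mono {p} {q} c p≤q e≤e′ e≤4 with <-cmp c p | <-cmp c q
... | tri< _ _ _    | tri< _ _ _    = ≤-refl
... | tri< c<p _ _  | tri≈ _ refl _ = ⊥-elim (<⇒≱ c<p p≤q)
... | tri< c<p _ _  | tri> _ _ q<c  = ⊥-elim (<-irrefl refl (<-trans c<p (≤-<-trans p≤q q<c)))
... | tri≈ _ refl _ | tri< _ _ _    = e≤4
... | tri≈ _ refl _ | tri≈ _ refl _ = e≤e′ refl
... | tri≈ _ refl _ | tri> _ _ q<c  = ⊥-elim (<⇒≱ q<c p≤q)
... | tri> _ _ _    | _             = z≤n

-- A profile gives, for every node (d , c), how many of its four slots carry the value b.
Profile : Set
Profile = ℕ → ℕ → ℕ

pathProfile : Seq → (ℕ → ℕ) → Profile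
pathProfile t e d = mark (pathColumn t d) (e d)

lower upper : Seq → Profile
lower t = pathProfile t (λ d → 1 + bit (t d))
upper t = pathProfile t (λ d → 2 + bit (t d))

turnRight : Seq → ℕ → Seq
turnRight u n i with <-cmp i n
... | tri< _ _ _ = u i
... | tri≈ _ _ _ = true
... | tri> _ _ _ = false

splitWeight : Seq → ℕ → ℕ → ℕ
splitWeight u n d with d ≤? n
... | yes _ = 1 + bit (turnRight u n d)
... | no  _ = 0

-- Separates the lower and upper profiles of the paths through the left subtree of the node
-- at depth n on u from those through its right subtree.
split : Seq → ℕ → Profile
split u n = pathProfile (turnRight u n) (splitWeight u n)

ExceedsDeeply : Profile → Profile → Set
ExceedsDeeply κ₁ κ₂ = ∀ m → ∃₂ λ d c → m ≤ d × c < 2 ^ d × κ₁ d c < κ₂ d c × κ₁ d c < 4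

from-does : ∀ {A : Set} {a? : Dec A} → does a? ≡ true → A
from-does {a? = yes a} _ = a

cellwise-at : ∀ {P : Cell → Set} (P? : Decidable P) i {x} → cellOf i ≡ x → cellwise P? i ≡ does (P? x)
cellwise-at P? _ = cong (does ∘ P?)

Below : Profile → Cell → Set
Below κ (d , c , s) = s < κ d c

below? : ∀ κ → Decidable (Below κ)
below? κ (d , c , s) = s <? κ d c

fill : Profile → Seq
fill κ = cellwise (below? κ)

fill-mono-from : ∀ {κ₁ κ₂} D → (∀ d c → D ≤ d → κ₁ d c ≤ κ₂ d c) →
                 ∀ i → D ≤ depth (cellOf i) → fill κ₁ i ≡ true → fill κ₂ i ≡ true
fill-mono-from {κ₁} {κ₂} D κ₁≤κ₂ i D≤d filled =
  dec-true (below? κ₂ (cellOf i))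
           (<-≤-trans (from-does {a? = below? κ₁ (cellOf i)} filled) (κ₁≤κ₂ _ _ D≤d))

Gain : ℕ → Profile → Profile → Cell → Set
Gain D κ₁ κ₂ x = D < depth x × ¬ Below κ₁ x × Below κ₂ x

gain? : ∀ D κ₁ κ₂ → Decidable (Gain D κ₁ κ₂)
gain? D κ₁ κ₂ x = (D <? depth x) ×-dec ¬? (below? κ₁ x) ×-dec below? κ₂ x

gain-⊆ : ∀ {D κ₁ κ₂} → cellwise (gain? D κ₁ κ₂) ⊆ fill κ₂ ∖ fill κ₁
gain-⊆ {D} {κ₁} {κ₂} i gained with from-does {a? = gain? D κ₁ κ₂ (cellOf i)} gained
... | _ , ¬below₁ , below₂ =
  dec-true (below? κ₂ (cellOf i)) below₂ , dec-false (below? κ₁ (cellOf i)) ¬below₁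

gain-dense : ∀ {κ₁ κ₂} → ExceedsDeeply κ₁ κ₂ → ∀ D →
             UpperDensityPos (cellwise (gain? D κ₁ κ₂))
gain-dense {κ₁} {κ₂} exceeds D = cellwise-dense (gain? D κ₁ κ₂) deep
  where
  deep : ∀ m → ∃ λ x → m ≤ depth x × ValidCell x × Gain D κ₁ κ₂ x
  deep m with exceeds (suc D + m)
  ... | d , c , D+m<d , c<2^d , κ₁<κ₂ , κ₁<4 =
    (d , c , κ₁ d c) , ≤-trans (m≤n+m m (suc D)) D+m<d , (c<2^d , κ₁<4) ,
    ≤-trans (s≤s (m≤m+n D m)) D+m<d , <-irrefl refl , κ₁<κ₂

lower≤upper : ∀ t d c → lower t d c ≤ upper t d c
lower≤upper t d c = mark-mono c ≤-refl (λ _ → n≤1+n _) (<⇒≤ (<⇒≤ (2+bit<4 (t d))))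

upper-exceeds-lower : ∀ t → ExceedsDeeply (lower t) (upper t)
upper-exceeds-lower t m = m , pathColumn t m , ≤-refl , pathColumn<2^ t m ,
  subst₂ _<_ (sym (mark-on-path p _)) (sym (mark-on-path p _)) ≤-refl ,
  subst (_< 4) (sym (mark-on-path p _)) (<⇒≤ (2+bit<4 (t m)))
  where p = pathColumn t m

module _ {u T : Seq} {n : ℕ} (agree : AgreeBelow n u T) where

  turnRight-agree : AgreeBelow n T (turnRight u n)
  turnRight-agree i i<n with <-cmp i n
  ... | tri< _ _ _   = sym (agree i i<n)
  ... | tri≈ i≮n _ _ = ⊥-elim (i≮n i<n)
  ... | tri> i≮n _ _ = ⊥-elim (i≮n i<n)

  turnRight-at : turnRight u n n ≡ true
  turnRight-at with <-cmp n n
  ... | tri< n<n _ _ = ⊥-elim (<-irrefl refl n<n)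
  ... | tri≈ _ _ _   = refl
  ... | tri> _ _ n<n = ⊥-elim (<-irrefl refl n<n)

  splitWeight-beyond : ∀ {d} → n < d → splitWeight u n d ≡ 0
  splitWeight-beyond {d} n<d with d ≤? n
  ... | yes d≤n = ⊥-elim (<⇒≱ n<d d≤n)
  ... | no  _   = refl

  module _ (Tn : T n ≡ true) where

    turnRight⊑ : turnRight u n ⊑ T
    turnRight⊑ i vi with <-cmp i n
    ... | tri< i<n _ _ = trans (sym (agree i i<n)) vi
    ... | tri≈ _ refl _ = Tn

    splitWeight≤ : ∀ d → splitWeight u n d ≤ 1 + bit (T d)
    splitWeight≤ d with d ≤? n
    ... | yes _ = s≤s (bit-mono (turnRight⊑ d))
    ... | no  _ = z≤n

    split≤lower : ∀ d c → split u n d c ≤ lower T d c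
    split≤lower d c = mark-mono c (pathColumn-mono turnRight⊑ d) (λ _ → splitWeight≤ d)
                        (≤-trans (splitWeight≤ d) (<⇒≤ (<⇒≤ (2+bit<4 (T d)))))

    lower-exceeds-split : ExceedsDeeply (split u n) (lower T)
    lower-exceeds-split m = d , pathColumn T d , m≤n+m m (suc n) , pathColumn<2^ T d , split<lower , split<4
      where
      d = suc n + m
      split≤0 : split u n d (pathColumn T d) ≤ 0
      split≤0 = subst (split u n d (pathColumn T d) ≤_) (splitWeight-beyond (m≤m+n (suc n) m))
                  (mark-≤ (splitWeight u n d) (pathColumn-mono turnRight⊑ d))
      split<lower : split u n d (pathColumn T d) < lower T d (pathColumn T d)
      split<lower = subst (split u n d (pathColumn T d) <_) (sym (mark-on-path (pathColumn T d) _))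
                      (s≤s (≤-trans split≤0 z≤n))
      split<4 : split u n d (pathColumn T d) < 4
      split<4 = ≤-trans (s≤s split≤0) (s≤s z≤n)

  module _ (Tn : T n ≡ false) where

    split-beyond-path : ∀ {d} → n < d → pathColumn T d < pathColumn (turnRight u n) d
    split-beyond-path = pathColumn-split turnRight-agree Tn turnRight-at

    split-on-path : ∀ {d} → n < d → split u n d (pathColumn T d) ≡ 4
    split-on-path {d} n<d = mark-left (splitWeight u n d) (split-beyond-path n<d)

    upper≤split : ∀ d c → n ≤ d → upper T d c ≤ split u n d c
    upper≤split d c n≤d with m≤n⇒m<n∨m≡n n≤d
    ... | inj₁ n<d  = mark-mono c (<⇒≤ (split-beyond-path n<d))
                        (λ eq → ⊥-elim (<-irrefl eq (split-beyond-path n<d))) (<⇒≤ (2+bit<4 (T d)))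
    ... | inj₂ refl = mark-mono c (≤-reflexive (pathColumn-cong n turnRight-agree)) (λ _ → weights)
                        (<⇒≤ (2+bit<4 (T n)))
      where
      weights : 2 + bit (T n) ≤ splitWeight u n n
      weights with n ≤? n
      ... | yes _  rewrite Tn | turnRight-at = ≤-refl
      ... | no n≰n = ⊥-elim (n≰n ≤-refl)

    split-exceeds-upper : ExceedsDeeply (upper T) (split u n)
    split-exceeds-upper m = d , pathColumn T d , m≤n+m m (suc n) , pathColumn<2^ T d , upper<split , upper<4
      where
      d = suc n + m
      upper<4 : upper T d (pathColumn T d) < 4
      upper<4 = subst (_< 4) (sym (mark-on-path (pathColumn T d) _)) (2+bit<4 (T d))
      upper<split : upper T d (pathColumn T d) < split u n d (pathColumn T d)
      upper<split = subst (upper T d (pathColumn T d) <_) (sym (split-on-path (m≤m+n (suc n) m))) upper<4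

swap : Seq → ℕ → ℕ → Seq
swap x i j k with k ≟ i | k ≟ j
... | yes _ | _     = x j
... | no  _ | yes _ = x i
... | no  _ | no  _ = x k

swap-left : ∀ x i j → swap x i j i ≡ x j
swap-left x i j with i ≟ i
... | yes _  = refl
... | no i≢i = ⊥-elim (i≢i refl)

swap-right : ∀ x i j → swap x i j j ≡ x i
swap-right x i j with j ≟ i | j ≟ j
... | yes refl | _      = refl
... | no  _    | yes _  = refl
... | no  _    | no j≢j = ⊥-elim (j≢j refl)

swap-other : ∀ x i j {k} → k ≢ i → k ≢ j → swap x i j k ≡ x k
swap-other x i j {k} k≢i k≢j with k ≟ i | k ≟ j
... | yes k≡i | _       = ⊥-elim (k≢i k≡i)
... | no  _   | yes k≡j = ⊥-elim (k≢j k≡j)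
... | no  _   | no  _   = refl

module Representation {a b : ℝ} (a<b : a <ℝ b) (W : Seq → ℝ)
  (pareto : UpperAsymptoticPareto a b W) (anonymity : Anonymity W) where

  val-mono : ∀ {β γ} → (β ≡ true → γ ≡ true) → val a b β ≤ℝ val a b γ
  val-mono {false} {false} _   = ≤ℝ-refl {a}
  val-mono {false} {true}  _   = <ℝ⇒≤ℝ {a} {b} a<b
  val-mono {true}  {true}  _   = ≤ℝ-refl {b}
  val-mono {true}  {false} β⇒γ with β⇒γ refl
  ... | ()

  pareto-≻ : ∀ {x y} S → y ⊑ x → UpperDensityPos S → S ⊆ x ∖ y → _≻_ W x y
  pareto-≻ {x} {y} S y⊑x dense gain = pareto x y S (λ i → val-mono (y⊑x i)) dense strict
    where
    strict : ∀ i → S i ≡ true → val a b (y i) <ℝ val a b (x i)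
    strict i Si with gain i Si
    ... | xi , yi rewrite xi | yi = a<b

  swap-∼ : ∀ x i j → _∼_ W x (swap x i j)
  swap-∼ x i j = anonymity x (swap x i j) i j (swap-right x i j) (sym (swap-left x i j)) (λ k → swap-other x i j)

  -- The positions below M where y exceeds x are exchanged, one at a time, with spare positions
  -- B + k at which x carries b, y carries a, and which the gain set S avoids.
  finite-exceptions : ∀ {x y S M B} → M ≤ B → UpperDensityPos S → S ⊆ x ∖ y →
    (∀ i → M ≤ i → y i ≡ true → x i ≡ true) →
    (∀ k → k < M → x (B + k) ≡ true × y (B + k) ≡ false × S (B + k) ≡ false) →
    W y ≤ℝ W x
  finite-exceptions {x} {y} {S} {M} {B} M≤B dense = repair M ≤-refl x
    where
    DominatesFrom : ℕ → Seq → Set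
    DominatesFrom N x = ∀ i → N ≤ i → y i ≡ true → x i ≡ true

    SparesBelow : ℕ → Seq → Set
    SparesBelow N x = ∀ k → k < N → x (B + k) ≡ true × y (B + k) ≡ false × S (B + k) ≡ false

    false≢true : false ≢ true
    false≢true ()

    dominated-from : ∀ {N} x → (y N ≡ true → x N ≡ true) → DominatesFrom (suc N) x → DominatesFrom N x
    dominated-from _ atN above i N≤i with m≤n⇒m<n∨m≡n N≤i
    ... | inj₁ N<i  = above i N<i
    ... | inj₂ refl = atN

    spares-below : ∀ {N} x → SparesBelow (suc N) x → SparesBelow N x
    spares-below _ spare k k<N = spare k (m<n⇒m<1+n k<N)

    repair : ∀ N → N ≤ M → ∀ x → S ⊆ x ∖ y → DominatesFrom N x → SparesBelow N x → W y ≤ℝ W x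
    repair zero    _   x gain dominated _ = proj₁ (pareto-≻ S (λ i → dominated i z≤n) dense gain)
    repair (suc N) N<M x gain dominated spare with y N in yN | x N in xN
    ... | false | _     = repair N (<⇒≤ N<M) x gain
                            (dominated-from x (λ yN≡t → ⊥-elim (false≢true (trans (sym yN) yN≡t))) dominated)
                            (spares-below x spare)
    ... | true  | true  = repair N (<⇒≤ N<M) x gain (dominated-from x (λ _ → xN) dominated)
                            (spares-below x spare)
    ... | true  | false =
      ≤ℝ-trans {W y} {W x′} {W x} (repair N (<⇒≤ N<M) x′ gain′ dominated′ spare′)
                                  (proj₁ (swap-∼ x N (B + N)))
      where
      x′ : Seq
      x′ = swap x N (B + N)
      B+N-spare = spare N ≤-refl
      gain′ : S ⊆ x′ ∖ y
      gain′ i Si = trans (swap-other x N (B + N) i≢N i≢B+N) (proj₁ (gain i Si)) , proj₂ (gain i Si)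
        where
        i≢N : i ≢ N
        i≢N refl = false≢true (trans (sym (proj₂ (gain i Si))) yN)
        i≢B+N : i ≢ B + N
        i≢B+N refl = false≢true (trans (sym (proj₂ (proj₂ B+N-spare))) Si)
      dominated′ : DominatesFrom N x′
      dominated′ = dominated-from x′ (λ _ → trans (swap-left x N (B + N)) (proj₁ B+N-spare)) above
        where
        above : DominatesFrom (suc N) x′
        above i N<i yi = trans (swap-other x N (B + N) i≢N i≢B+N) (dominated i N<i yi)
          where
          i≢N : i ≢ N
          i≢N refl = <-irrefl refl N<i
          i≢B+N : i ≢ B + N
          i≢B+N refl = false≢true (trans (sym (proj₁ (proj₂ B+N-spare))) yi)
      spare′ : SparesBelow N x′
      spare′ k k<N = trans (swap-other x N (B + N) B+k≢N B+k≢B+N) (proj₁ (spares-below x spare k k<N)) ,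
                     proj₂ (spares-below x spare k k<N)
        where
        B+k≢N : B + k ≢ N
        B+k≢N eq = <-irrefl (sym eq) (≤-trans (≤-trans N<M M≤B) (m≤m+n B k))
        B+k≢B+N : B + k ≢ B + N
        B+k≢B+N eq = <-irrefl (+-cancelˡ-≡ B k N eq) k<N

  profile-≻ : ∀ {κ₁ κ₂} → (∀ d c → κ₁ d c ≤ κ₂ d c) → ExceedsDeeply κ₁ κ₂ →
              _≻_ W (fill κ₂) (fill κ₁)
  profile-≻ {κ₁} {κ₂} κ₁≤κ₂ exceeds = pareto-≻ (cellwise (gain? 0 κ₁ κ₂))
    (λ i → fill-mono-from {κ₁} {κ₂} 0 (λ d c _ → κ₁≤κ₂ d c) i z≤n)
    (gain-dense exceeds 0) (gain-⊆ {0} {κ₁} {κ₂})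

  upper-≻-lower : ∀ t → _≻_ W (fill (upper t)) (fill (lower t))
  upper-≻-lower t = profile-≻ (lower≤upper t) (upper-exceeds-lower t)

  split-≤-lower : ∀ {u T n} → AgreeBelow n u T → T n ≡ true → W (fill (split u n)) ≤ℝ W (fill (lower T))
  split-≤-lower agree Tn = proj₁ (profile-≻ (split≤lower agree Tn) (lower-exceeds-split agree Tn))

  -- Below depth n the upper profile of T may exceed the split profile, so the finitely many
  -- positions of depth < n are moved into the block of one cell of depth D deeper than all of them.
  upper-≤-split : ∀ {u T n} → AgreeBelow n u T → T n ≡ false →
                  W (fill (upper T)) ≤ℝ W (fill (split u n))
  upper-≤-split {u} {T} {n} agree Tn =
    finite-exceptions M≤B (gain-dense (split-exceeds-upper agree Tn) D) (gain-⊆ {D} {upper T} {split u n})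
                      dominated spare
    where
    M = levelStart (levelStart n * 4)
    D = suc n + M
    spareCell = D , pathColumn T D , 3
    j = cellIndex spareCell
    M≤B : M ≤ levelStart j
    M≤B = ≤-trans (m≤n+m M (suc n)) (≤-trans (depth≤cellIndex spareCell) (n≤levelStart j))
    dominated : ∀ i → M ≤ i → fill (upper T) i ≡ true → fill (split u n) i ≡ true
    dominated i M≤i =
      fill-mono-from {upper T} {split u n} n (λ d c → upper≤split agree Tn d c) i (depth-cellOf n M≤i)
    in-spareCell : ∀ k → k < M → cellOf (levelStart j + k) ≡ spareCell
    in-spareCell k k<M = trans (cellOf-block j (<-≤-trans k<M (≤-trans M≤B (<⇒≤ (levelStart<2^ j)))))
                               (cell-cellIndex spareCell (pathColumn<2^ T D , ≤-refl))
    upper≤3 : upper T D (pathColumn T D) ≤ 3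
    upper≤3 = subst (_≤ 3) (sym (mark-on-path (pathColumn T D) _)) (≤-pred (2+bit<4 (T D)))
    3<split : 3 < split u n D (pathColumn T D)
    3<split = subst (3 <_) (sym (split-on-path agree Tn (m≤m+n (suc n) M))) ≤-refl
    spare : ∀ k → k < M → fill (split u n) (levelStart j + k) ≡ true ×
                          fill (upper T) (levelStart j + k) ≡ false ×
                          cellwise (gain? D (upper T) (split u n)) (levelStart j + k) ≡ false
    spare k k<M =
      trans (at (below? (split u n))) (dec-true (below? (split u n) spareCell) 3<split) ,
      trans (at (below? (upper T)))
            (dec-false (below? (upper T) spareCell) (λ 3<upper → <⇒≱ 3<upper upper≤3)) ,
      trans (at (gain? D (upper T) (split u n)))
            (dec-false (gain? D (upper T) (split u n) spareCell) (λ gain → <-irrefl refl (proj₁ gain)))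
      where
      at : ∀ {P : Cell → Set} (P? : Decidable P) → cellwise P? (levelStart j + k) ≡ does (P? spareCell)
      at P? = cellwise-at P? (levelStart j + k) (in-spareCell k k<M)

  enumerate-ℚ² : Enumeration (ℚ × ℚ)
  enumerate-ℚ² = enumerate-× enumerate-ℚ enumerate-ℚ

  -- Bit n of the diagonal path places it on the side of the n-th rational gap q < r on
  -- which W (fill (split u n)) lies, u being the bits chosen before.
  open Diagonal (λ n u → LocatedAt (proj₁ enumerate-ℚ² n) (W (fill (split u n))))
                (λ n u → locate (proj₁ enumerate-ℚ² n) (W (fill (split u n))))

  no-gap : ∀ q r → q <ℚ r → U (W (fill (lower diagonal))) q → L (W (fill (upper diagonal))) r → ⊥
  no-gap q r q<r Uq Lr with proj₂ enumerate-ℚ² (q , r)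
  ... | n , qr with subst (λ qr → LocatedAt qr (W (fill (split (prefix n) n))) (diagonal n)) qr
                  (diagonal-satisfies n) q<r
  ...   | inj₁ (Tn , Lq) = disjoint (W (fill (lower diagonal))) q (split-≤-lower (prefix-agree n) Tn q Lq) Uq
  ...   | inj₂ (Tn , Ur) = disjoint (W (fill (split (prefix n) n))) r (upper-≤-split (prefix-agree n) Tn r Lr) Ur

  impossible : ⊥
  impossible = proj₂ (upper-≻-lower diagonal)
                     (≤ℝ-if-no-gap (W (fill (lower diagonal))) (W (fill (upper diagonal))) no-gap)

proposition1 : (a b : ℝ) → a <ℝ b →
    ¬ (Σ (Seq → ℝ) λ W → UpperAsymptoticPareto a b W × Anonymity W)
proposition1 a b a<b (W , pareto , anonymity) = Representation.impossible a<b W pareto anonymity
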